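{- Let $T=T[1..n]$ be a string over a finite alphabet and let $\mathrm{PH}(T)$ be its position heap (defined in the context). If $j<n$ is the secondary position of some node of $\mathrm{PH}(T)$, then $j+1$ is also the secondary position of some node of $\mathrm{PH}(T)$.
   Context: Strings are indexed from 1; $T[i..j]=T[i]\cdots T[j]$. A trie is a rooted tree with edges directed away from the root labeled by letters, distinct letters on edges leaving the same node; a node's path label is the string read from the root to it, and a string is represented if it is some node's path label. The position heap $\mathrm{PH}(T)$ is built as follows: start with a single root node; then for $i=1,2,\ldots,n$ in this order insert the suffix $T[i..n]$: if $T[i..n]$ is already represented, add position $i$ to the node with path label $T[i..n]$; otherwise let $v'$ be the longest prefix of $T[i..n]$ that is represented, $a$ the next letter of $T[i..n]$ after $v'$, and create a new child of node $v'$ via an $a$-edge storing position $i$. Every node then stores one or two positions; if a node stores two positions $i<j$, then $i$ is called its primary position and $j$ its secondary position (a node storing a single position has that position as primary). -}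

module Defs where

open import Data.Nat using (ℕ; zero; suc; _<_)
open import Data.Fin using (Fin)
import Data.Fin as Fin
open import Data.List using (List; []; _∷_; _++_; [_]; map)
open import Data.List.Properties using (≡-dec)
open import Data.List.Relation.Unary.Any using (any?)
open import Data.List.Membership.Propositional using (_∈_)
open import Data.Product using (_×_; _,_; proj₁; proj₂; ∃-syntax)
open import Relation.Nullary using (yes; no; Dec)
open import Relation.Binary.PropositionalEquality using (_≡_)

-- Strings over the finite alphabet Fin σ; position i of T (1-based) is the
-- i-th element of the list.
Str : ℕ → Set
Str σ = List (Fin σ)

module _ {σ : ℕ} where

  _≟s_ : (u v : Str σ) → Dec (u ≡ v)
  _≟s_ = ≡-dec Fin._≟_

  -- A node of the trie: its path label and the list of stored positions
  -- (in order of insertion).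
  Node : Set
  Node = Str σ × List ℕ

  -- A trie is represented by the list of its nodes (path labels are
  -- distinct and the set of labels is prefix closed).
  Heap : Set
  Heap = List Node

  represented? : (u : Str σ) → (h : Heap) → Dec (∃[ x ] (x ∈ h × proj₁ x ≡ u))
  represented? u h with any? (λ x → proj₁ x ≟s u) h
  ... | yes p = yes (lift p)
    where
    open import Data.List.Relation.Unary.Any using (Any; here; there)
    open import Relation.Binary.PropositionalEquality using (refl)
    lift : ∀ {h'} → Any (λ x → proj₁ x ≡ u) h' → ∃[ x ] (x ∈ h' × proj₁ x ≡ u)
    lift (here {x = x} e) = x , here refl , e
    lift (there q) with lift q
    ... | x , m , e = x , there m , e
  ... | no ¬p = no (λ { (x , m , e) → ¬p (back m e) })
    where
    open import Data.List.Relation.Unary.Any using (Any; here; there)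
    open import Relation.Binary.PropositionalEquality using (refl; subst)
    back : ∀ {h' x} → x ∈ h' → proj₁ x ≡ u → Any (λ y → proj₁ y ≡ u) h'
    back (here refl) e = here e
    back (there m) e = there (back m e)

  addPos : Str σ → ℕ → Heap → Heap
  addPos u i [] = []
  addPos u i ((l , ps) ∷ h) with l ≟s u
  ... | yes _ = (l , ps ++ [ i ]) ∷ addPos u i h
  ... | no _  = (l , ps) ∷ addPos u i h

  -- Walk down the trie along the string: acc is the represented prefix
  -- read so far; returns (longest represented prefix v') ++ [a], the label
  -- of the new child of v' via the a-edge.
  newLabel : Heap → Str σ → Str σ → Str σ
  newLabel h acc [] = acc
  newLabel h acc (a ∷ s) with represented? (acc ++ [ a ]) h
  ... | yes _ = newLabel h (acc ++ [ a ]) s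
  ... | no _  = acc ++ [ a ]

  insert : Str σ → ℕ → Heap → Heap
  insert s i h with represented? s h
  ... | yes _ = addPos s i h
  ... | no _  = h ++ [ (newLabel h [] s , i ∷ []) ]

  build : ℕ → Str σ → Heap → Heap
  build i [] h = h
  build i (a ∷ s) h = build (suc i) s (insert (a ∷ s) i h)

  PH : Str σ → Heap
  PH T = build 1 T (([] , []) ∷ [])

  IsSecondary : Str σ → ℕ → Set
  IsSecondary T j = ∃[ u ] ∃[ i ] (i < j × (u , i ∷ j ∷ []) ∈ PH T)

-- A node acquires a secondary position j only when T[j..n] is already
-- represented at step j, and its label is then T[j..n] = T[j] ∷ T[j+1..n].
-- The heap stays prefix closed and, up to the one node created by the latest
-- insertion, closed under taking tails; hence T[j+1..n] is represented after
-- step j.  Step j+1 therefore adds j+1 to the existing node T[j+1..n], which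
-- holds a single position: every node with two positions b ≤ j has the label
-- T[b] ∷ T[b+1..n], which is longer.
module Submission where

open import Defs
open import Data.Nat using (ℕ; zero; suc; _<_; _≤_; _∸_; s≤s)
open import Data.Nat.Properties
  using (≤-refl; ≤-trans; <⇒≢; 1+n≰n; n<1+n; m≤n⇒m≤1+n; m≤n⇒m<n∨m≡n; ∸-monoʳ-≤; m∸n≡0⇒m≤n; module ≤-Reasoning)
open import Data.List using (List; []; _∷_; _++_; [_]; _∷ʳ_; length; drop; initLast; _∷ʳ′_)
open import Data.List.Properties using (∷-injectiveʳ; ++-assoc; ++-identityʳ; ++-conicalˡ; length-drop; ∷ʳ-injectiveˡ; ∷ʳ-injectiveʳ)
open import Data.List.Membership.Propositional using (_∈_)
open import Data.List.Membership.Propositional.Properties using (∈-++⁺ˡ; ∈-++⁺ʳ; ∈-++⁻)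
open import Data.List.Relation.Unary.Any using (here; there)
open import Data.Product using (_×_; _,_; proj₁; ∃-syntax)
open import Data.Sum using (_⊎_; inj₁; inj₂)
import Data.Sum as Sum
import Data.Product as Prod
open import Data.Empty using (⊥; ⊥-elim)
open import Relation.Nullary using (yes; no; ¬_)
open import Relation.Binary.PropositionalEquality using (_≡_; _≢_; refl; sym; trans; cong; subst)

module _ {A : Set} where

  infix 4 _⊑_
  _⊑_ : List A → List A → Set
  u ⊑ s = ∃[ z ] (u ++ z ≡ s)

  ⊑-∷ʳ⁻ : ∀ {u v x} → u ⊑ v ∷ʳ x → u ≡ v ∷ʳ x ⊎ u ⊑ v
  ⊑-∷ʳ⁻ {u} (z , eq) with initLast z
  ⊑-∷ʳ⁻ {u} (.([]) , eq)     | []      = inj₁ (trans (sym (++-identityʳ u)) eq)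
  ⊑-∷ʳ⁻ {u} (.(z ∷ʳ y) , eq) | z ∷ʳ′ y = inj₂ (z , ∷ʳ-injectiveˡ (u ++ z) _ (trans (++-assoc u z [ y ]) eq))

  drop-suc : ∀ k (xs : List A) {y ys} → drop k xs ≡ y ∷ ys → drop (suc k) xs ≡ ys
  drop-suc zero    (x ∷ xs) refl = refl
  drop-suc (suc k) (x ∷ xs) eq   = drop-suc k xs eq

  drop≡[]⇒length≤ : ∀ k (xs : List A) → drop k xs ≡ [] → length xs ≤ k
  drop≡[]⇒length≤ k xs eq = m∸n≡0⇒m≤n (trans (sym (length-drop k xs)) (cong length eq))

  drop≢∷drop : ∀ {b t} (xs : List A) {y} → b ≤ t → drop t xs ≢ y ∷ drop b xs
  drop≢∷drop {b} {t} xs {y} b≤t eq = <⇒≢ shorter (cong length eq)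
    where
    open ≤-Reasoning
    shorter : length (drop t xs) < length (y ∷ drop b xs)
    shorter = begin-strict
      length (drop t xs)      ≡⟨ length-drop t xs ⟩
      length xs ∸ t           ≤⟨ ∸-monoʳ-≤ (length xs) b≤t ⟩
      length xs ∸ b           <⟨ n<1+n _ ⟩
      suc (length xs ∸ b)     ≡⟨ cong suc (sym (length-drop b xs)) ⟩
      length (y ∷ drop b xs)  ∎

module _ {σ : ℕ} where

  Represented : Str σ → Heap {σ} → Set
  Represented u h = ∃[ x ] (x ∈ h × proj₁ x ≡ u)

  PrefixClosed : Heap {σ} → Set
  PrefixClosed h = ∀ {x y} → x ⊑ y → Represented y h → Represented x h

  Frontier : Str σ → Heap {σ} → Str σ → Set
  Frontier s h u = u ⊑ s × ∃[ w ] ∃[ d ] (u ≡ w ∷ʳ d × Represented w h)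

  -- The tail of a node is represented, or else the node was created by the
  -- latest insertion and its tail is a frontier string of the next suffix r.
  TailClosedAlong : Str σ → Heap {σ} → Set
  TailClosedAlong r h = ∀ {c w} → Represented (c ∷ w) h → Represented w h ⊎ Frontier r h w

  SecondaryIn : Heap {σ} → ℕ → Set
  SecondaryIn h j = ∃[ l ] ∃[ i ] (i < j × (l , i ∷ j ∷ []) ∈ h)

  addPos-∈-≢ : ∀ s i (h : Heap {σ}) {l ps} → (l , ps) ∈ h → l ≢ s → (l , ps) ∈ addPos s i h
  addPos-∈-≢ s i ((l , ps) ∷ h) (here refl) l≢s with l ≟s s
  ... | yes l≡s = ⊥-elim (l≢s l≡s)
  ... | no _    = here refl
  addPos-∈-≢ s i ((l , _) ∷ h) (there m) l≢s with l ≟s s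
  ... | yes _ = there (addPos-∈-≢ s i h m l≢s)
  ... | no _  = there (addPos-∈-≢ s i h m l≢s)

  addPos-∈-≡ : ∀ s i (h : Heap {σ}) {l ps} → (l , ps) ∈ h → l ≡ s → (l , ps ∷ʳ i) ∈ addPos s i h
  addPos-∈-≡ s i ((l , ps) ∷ h) (here refl) l≡s with l ≟s s
  ... | yes _   = here refl
  ... | no l≢s  = ⊥-elim (l≢s l≡s)
  addPos-∈-≡ s i ((l , _) ∷ h) (there m) l≡s with l ≟s s
  ... | yes _ = there (addPos-∈-≡ s i h m l≡s)
  ... | no _  = there (addPos-∈-≡ s i h m l≡s)

  addPos-∈⁻ : ∀ s i (h : Heap {σ}) {l ps′} → (l , ps′) ∈ addPos s i h →
              (l , ps′) ∈ h ⊎ ∃[ ps ] ((l , ps) ∈ h × ps′ ≡ ps ∷ʳ i × l ≡ s)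
  addPos-∈⁻ s i ((l , ps) ∷ h) m with l ≟s s | m
  ... | yes l≡s | here refl = inj₂ (ps , here refl , refl , l≡s)
  ... | no _    | here refl = inj₁ (here refl)
  ... | yes _   | there m′  = Sum.map there (Prod.map₂ (Prod.map₁ there)) (addPos-∈⁻ s i h m′)
  ... | no _    | there m′  = Sum.map there (Prod.map₂ (Prod.map₁ there)) (addPos-∈⁻ s i h m′)

  addPos-represented : ∀ s i (h : Heap {σ}) {x} → Represented x h → Represented x (addPos s i h)
  addPos-represented s i h ((l , ps) , m , refl) with l ≟s s
  ... | yes l≡s = (l , ps ∷ʳ i) , addPos-∈-≡ s i h m l≡s , refl
  ... | no l≢s  = (l , ps) , addPos-∈-≢ s i h m l≢s , refl

  insert-∈-≢ : ∀ s i (h : Heap {σ}) {l ps} → (l , ps) ∈ h → l ≢ s → (l , ps) ∈ insert s i h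
  insert-∈-≢ s i h m l≢s with represented? s h
  ... | yes _ = addPos-∈-≢ s i h m l≢s
  ... | no _  = ∈-++⁺ˡ m

  insert-∈-≡ : ∀ s i (h : Heap {σ}) {l ps} → (l , ps) ∈ h → l ≡ s → (l , ps ∷ʳ i) ∈ insert s i h
  insert-∈-≡ s i h m l≡s with represented? s h
  ... | yes _  = addPos-∈-≡ s i h m l≡s
  ... | no ¬rs = ⊥-elim (¬rs (_ , m , l≡s))

  insert-∈⁻ : ∀ s i (h : Heap {σ}) {l ps′} → (l , ps′) ∈ insert s i h →
      (l , ps′) ∈ h
    ⊎ ∃[ ps ] ((l , ps) ∈ h × ps′ ≡ ps ∷ʳ i × l ≡ s × Represented s h)
    ⊎ (l ≡ newLabel h [] s × ps′ ≡ i ∷ [] × ¬ Represented s h)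
  insert-∈⁻ s i h m with represented? s h
  ... | yes rs = Sum.map₂ (λ (ps , m′ , eq , l≡s) → inj₁ (ps , m′ , eq , l≡s , rs)) (addPos-∈⁻ s i h m)
  ... | no ¬rs with ∈-++⁻ h m
  ...   | inj₁ m′          = inj₁ m′
  ...   | inj₂ (here refl) = inj₂ (inj₂ (refl , refl , ¬rs))

  insert-represented : ∀ s i (h : Heap {σ}) {x} → Represented x h → Represented x (insert s i h)
  insert-represented s i h r with represented? s h
  insert-represented s i h r            | yes _ = addPos-represented s i h r
  insert-represented s i h (p , m , eq) | no _  = p , ∈-++⁺ˡ m , eq

  insert-represented⁻ : ∀ s i (h : Heap {σ}) {x} → Represented x (insert s i h) →
                        Represented x h ⊎ (x ≡ newLabel h [] s × ¬ Represented s h)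
  insert-represented⁻ s i h (_ , m , refl) with insert-∈⁻ s i h m
  ... | inj₁ m′                       = inj₁ (_ , m′ , refl)
  ... | inj₂ (inj₁ (_ , m′ , _))      = inj₁ (_ , m′ , refl)
  ... | inj₂ (inj₂ (l≡new , _ , ¬rs)) = inj₂ (l≡new , ¬rs)

  insert-represents-newLabel : ∀ s i (h : Heap {σ}) → ¬ Represented s h →
                               Represented (newLabel h [] s) (insert s i h)
  insert-represents-newLabel s i h ¬rs with represented? s h
  ... | yes rs = ⊥-elim (¬rs rs)
  ... | no _   = _ , ∈-++⁺ʳ h (here refl) , refl

  newLabel-parent : (h : Heap {σ}) {acc : Str σ} → Represented acc h → ∀ c s →
    ∃[ v ] ∃[ d ] (newLabel h acc (c ∷ s) ≡ v ∷ʳ d × Represented v h × v ∷ʳ d ⊑ acc ++ c ∷ s)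
  newLabel-parent h {acc} racc c s with represented? (acc ++ [ c ]) h
  newLabel-parent h {acc} racc c []      | yes _ = acc , c , refl , racc , [] , ++-identityʳ (acc ∷ʳ c)
  newLabel-parent h {acc} racc c (d ∷ s) | yes racc′ with newLabel-parent h racc′ d s
  ... | v , e , eq , rv , z , ez = v , e , eq , rv , z , trans ez (++-assoc acc [ c ] (d ∷ s))
  newLabel-parent h {acc} racc c s       | no _  = acc , c , refl , racc , s , ++-assoc acc [ c ] s

  newLabel-extension : (h : Heap {σ}) → PrefixClosed h → ∀ acc x c z → Represented (acc ++ x) h →
    Represented (acc ++ (x ∷ʳ c)) h ⊎ newLabel h acc ((x ∷ʳ c) ++ z) ≡ acc ++ (x ∷ʳ c)
  newLabel-extension h pc acc [] c z _ with represented? (acc ++ [ c ]) h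
  ... | yes rc = inj₁ rc
  ... | no _   = inj₂ refl
  newLabel-extension h pc acc (d ∷ x) c z r with represented? (acc ++ [ d ]) h
  ... | yes _ = Sum.map (subst (λ q → Represented q h) assoc) (λ eq → trans eq assoc)
                  (newLabel-extension h pc (acc ∷ʳ d) x c z (subst (λ q → Represented q h) (sym (++-assoc acc [ d ] x)) r))
    where
    assoc : (acc ∷ʳ d) ++ (x ∷ʳ c) ≡ acc ++ (d ∷ x ∷ʳ c)
    assoc = ++-assoc acc [ d ] (x ∷ʳ c)
  ... | no ¬rd = ⊥-elim (¬rd (pc (x , ++-assoc acc [ d ] x) r))

  insert-represents-frontier : ∀ s i (h : Heap {σ}) {u} → PrefixClosed h → Frontier s h u →
                               Represented u (insert s i h)
  insert-represents-frontier s i h pc ((z , refl) , w , d , refl , rw) with represented? ((w ∷ʳ d) ++ z) h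
  ... | yes rs = addPos-represented _ i h (pc (z , refl) rs)
  ... | no _ with newLabel-extension h pc [] w d z rw
  ...   | inj₁ (p , m , eq) = p , ∈-++⁺ˡ m , eq
  ...   | inj₂ eq           = _ , ∈-++⁺ʳ h (here refl) , eq

  insert-prefixClosed : ∀ s i (h : Heap {σ}) → Represented [] h → PrefixClosed h → PrefixClosed (insert s i h)
  insert-prefixClosed s i h root pc x⊑y ry with insert-represented⁻ s i h ry
  insert-prefixClosed s       i h root pc x⊑y ry | inj₁ ry′       = insert-represented s i h (pc x⊑y ry′)
  insert-prefixClosed []      i h root pc x⊑y ry | inj₂ (_ , ¬rs) = ⊥-elim (¬rs root)
  insert-prefixClosed (c ∷ s) i h root pc {x} x⊑y ry | inj₂ (y≡new , ¬rs) with newLabel-parent h root c s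
  ... | v , d , new≡vd , rv , _ with ⊑-∷ʳ⁻ (subst (x ⊑_) (trans y≡new new≡vd) x⊑y)
  ...   | inj₁ x≡vd = subst (λ q → Represented q (insert (c ∷ s) i h)) (trans new≡vd (sym x≡vd))
                        (insert-represents-newLabel (c ∷ s) i h ¬rs)
  ...   | inj₂ x⊑v  = insert-represented (c ∷ s) i h (pc x⊑v rv)

  tail-represented : ∀ {h : Heap {σ}} {c r} → PrefixClosed h → TailClosedAlong (c ∷ r) h →
                     Represented (c ∷ r) h → Represented r h
  tail-represented pc tc rcr with tc rcr
  ... | inj₁ rr         = rr
  ... | inj₂ (r⊑cr , _) = pc r⊑cr rcr

  insert-represents-tail : ∀ s i (h : Heap {σ}) {c w} → PrefixClosed h → TailClosedAlong s h →
                           Represented (c ∷ w) h → Represented w (insert s i h)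
  insert-represents-tail s i h pc tc rcw with tc rcw
  ... | inj₁ rw = insert-represented s i h rw
  ... | inj₂ fw = insert-represents-frontier s i h pc fw

  insert-tailClosedAlong : ∀ c r i (h : Heap {σ}) → Represented [] h → PrefixClosed h →
                           TailClosedAlong (c ∷ r) h → TailClosedAlong r (insert (c ∷ r) i h)
  insert-tailClosedAlong c r i h root pc tc rcw with insert-represented⁻ (c ∷ r) i h rcw
  ... | inj₁ rcw′ = inj₁ (insert-represents-tail (c ∷ r) i h pc tc rcw′)
  ... | inj₂ (cw≡new , _) with newLabel-parent h root c r
  ...   | v , d , new≡vd , rv , vd⊑cr = tail-of-new v (trans cw≡new new≡vd) rv vd⊑cr
    where
    h′ : Heap {σ}
    h′ = insert (c ∷ r) i h
    tail-of-new : ∀ {c′ w} v → c′ ∷ w ≡ v ∷ʳ d → Represented v h → v ∷ʳ d ⊑ c ∷ r →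
                  Represented w h′ ⊎ Frontier r h′ w
    tail-of-new []       refl _  _        = inj₁ (insert-represented (c ∷ r) i h root)
    tail-of-new (e ∷ v′) refl rv (z , eq) =
      inj₂ ((z , ∷-injectiveʳ eq) , v′ , d , refl , insert-represents-tail (c ∷ r) i h pc tc rv)

module Construction {σ : ℕ} (T : Str σ) where

  -- Positions are 1-based, so the label T[b..n] of a node with secondary
  -- position b is drop (b - 1) T, written here as y ∷ drop b T.
  Positions : ℕ → Str σ → List ℕ → Set
  Positions t l []              = l ≡ []
  Positions t l (a ∷ [])        = a ≤ t
  Positions t l (a ∷ b ∷ [])    = a < b × b ≤ t × ∃[ y ] (l ≡ y ∷ drop b T)
  Positions t l (_ ∷ _ ∷ _ ∷ _) = ⊥

  Positions-suc : ∀ {t l} ps → Positions t l ps → Positions (suc t) l ps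
  Positions-suc []              p                = p
  Positions-suc (_ ∷ [])        a≤t              = m≤n⇒m≤1+n a≤t
  Positions-suc (_ ∷ _ ∷ [])    (a<b , b≤t , eq) = a<b , m≤n⇒m≤1+n b≤t , eq
  Positions-suc (_ ∷ _ ∷ _ ∷ _) ()

  -- h is the heap after inserting positions 1, …, t, and r = T[t+1..n] is
  -- still to be inserted.
  record Invariant (t : ℕ) (r : Str σ) (h : Heap {σ}) : Set where
    field
      root-represented : Represented [] h
      prefixClosed     : PrefixClosed h
      tailClosed       : TailClosedAlong r h
      positions        : ∀ {l ps} → (l , ps) ∈ h → Positions t l ps
      secondary-tail   : ∀ {l a b} → (l , a ∷ b ∷ []) ∈ h → Represented (drop b T) h
      secondary-suc    : ∀ {l a b} → (l , a ∷ b ∷ []) ∈ h → suc b ≤ t → SecondaryIn h (suc b)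

  module Step {t c r} {h : Heap {σ}} (suffix : drop t T ≡ c ∷ r) (inv : Invariant t (c ∷ r) h) where
    open Invariant inv

    h′ : Heap {σ}
    h′ = insert (c ∷ r) (suc t) h

    secondary-label-≢ : ∀ {l a b} → (l , a ∷ b ∷ []) ∈ h → l ≢ c ∷ r
    secondary-label-≢ m l≡cr with positions m
    ... | _ , b≤t , _ , refl = drop≢∷drop T b≤t (trans suffix (sym l≡cr))

    suffix-node-single : ∀ {l ps} → (l , ps) ∈ h → l ≡ c ∷ r → ∃[ a ] (ps ≡ a ∷ [] × a ≤ t)
    suffix-node-single {ps = []} m l≡cr with trans (sym (positions m)) l≡cr
    ... | ()
    suffix-node-single {ps = a ∷ []}        m _    = a , refl , positions m
    suffix-node-single {ps = _ ∷ _ ∷ []}    m l≡cr = ⊥-elim (secondary-label-≢ m l≡cr)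
    suffix-node-single {ps = _ ∷ _ ∷ _ ∷ _} m _    = ⊥-elim (positions m)

    positions′ : ∀ {l ps} → (l , ps) ∈ h′ → Positions (suc t) l ps
    positions′ m with insert-∈⁻ (c ∷ r) (suc t) h m
    ... | inj₁ m′ = Positions-suc _ (positions m′)
    ... | inj₂ (inj₂ (_ , refl , _)) = ≤-refl
    ... | inj₂ (inj₁ (_ , m′ , refl , refl , _)) with suffix-node-single m′ refl
    ...   | _ , refl , a≤t = s≤s a≤t , ≤-refl , c , cong (c ∷_) (sym (drop-suc t T suffix))

    secondary-tail′ : ∀ {l a b} → (l , a ∷ b ∷ []) ∈ h′ → Represented (drop b T) h′
    secondary-tail′ m with insert-∈⁻ (c ∷ r) (suc t) h m
    ... | inj₁ m′ = insert-represented _ _ h (secondary-tail m′)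
    ... | inj₂ (inj₂ (_ , () , _))
    ... | inj₂ (inj₁ (ps , _ , eq , _ , rcr)) with ∷ʳ-injectiveʳ (_ ∷ []) ps eq
    ...   | refl = subst (λ q → Represented q h′) (sym (drop-suc t T suffix))
                     (insert-represented _ _ h (tail-represented prefixClosed tailClosed rcr))

    secondary-at-t : ∀ {l a} → (l , a ∷ t ∷ []) ∈ h → SecondaryIn h′ (suc t)
    secondary-at-t m with subst (λ q → Represented q h) suffix (secondary-tail m)
    ... | (l′ , _) , m′ , l′≡cr with suffix-node-single m′ l′≡cr
    ...   | a′ , refl , a′≤t = l′ , a′ , s≤s a′≤t , insert-∈-≡ _ _ h m′ l′≡cr

    secondary-suc′ : ∀ {l a b} → (l , a ∷ b ∷ []) ∈ h′ → suc b ≤ suc t → SecondaryIn h′ (suc b)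
    secondary-suc′ m sb≤st with insert-∈⁻ (c ∷ r) (suc t) h m
    ... | inj₂ (inj₂ (_ , () , _))
    ... | inj₂ (inj₁ (ps , _ , eq , _)) =
      ⊥-elim (1+n≰n (subst (λ k → suc k ≤ suc t) (∷ʳ-injectiveʳ (_ ∷ []) ps eq) sb≤st))
    ... | inj₁ m′ with positions m′
    ...   | _ , b≤t , _ with m≤n⇒m<n∨m≡n b≤t
    ...     | inj₂ refl = secondary-at-t m′
    ...     | inj₁ b<t with secondary-suc m′ b<t
    ...       | l′ , a′ , a′<sb , m″ = l′ , a′ , a′<sb , insert-∈-≢ _ _ h m″ (secondary-label-≢ m″)

    invariant : Invariant (suc t) r h′
    invariant = record
      { root-represented = insert-represented _ _ h root-represented
      ; prefixClosed     = insert-prefixClosed _ _ h root-represented prefixClosed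
      ; tailClosed       = insert-tailClosedAlong c r (suc t) h root-represented prefixClosed tailClosed
      ; positions        = positions′
      ; secondary-tail   = secondary-tail′
      ; secondary-suc    = secondary-suc′
      }

  build-invariant : ∀ t r (h : Heap {σ}) → drop t T ≡ r → Invariant t r h →
                    ∃[ t′ ] (length T ≤ t′ × Invariant t′ [] (build (suc t) r h))
  build-invariant t []      h suffix inv = t , drop≡[]⇒length≤ t T suffix , inv
  build-invariant t (c ∷ r) h suffix inv =
    build-invariant (suc t) r _ (drop-suc t T suffix) (Step.invariant suffix inv)

  root : Heap {σ}
  root = ([] , []) ∷ []

  root-invariant : Invariant 0 T root
  root-invariant = record
    { root-represented = _ , here refl , refl
    ; prefixClosed     = prefixClosed
    ; tailClosed       = λ { (_ , here refl , ()) ; (_ , there () , _) }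
    ; positions        = λ { (here refl) → refl ; (there ()) }
    ; secondary-tail   = λ { (here ()) ; (there ()) }
    ; secondary-suc    = λ { (here ()) ; (there ()) }
    }
    where
    prefixClosed : PrefixClosed root
    prefixClosed (z , x++z≡y) (_ , here refl , refl) = _ , here refl , sym (++-conicalˡ _ z x++z≡y)

open Construction using (Invariant; build-invariant; root; root-invariant)

lemma2 : (σ : ℕ) (T : Str σ) (j : ℕ) → j < length T → IsSecondary T j → IsSecondary T (suc j)
lemma2 σ T j j<n (_ , _ , _ , m) with build-invariant T 0 T (root T) refl (root-invariant T)
... | _ , n≤t , inv = Invariant.secondary-suc inv m (≤-trans j<n n≤t)
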